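{- Let $P$ be a finite poset and let $x \in P$ be a $\chi$-point of $P$, i.e. $\chi(P_{>x}) = 1$ where $P_{>x} = \{y \in P \mid y > x\}$. If two functions $h, h' : P \to \mathbb{Z}$ satisfy $h(y) = h'(y)$ for every $y \in P$ with $y \neq x$, then \[ \int_{P} h \, d\chi = \int_{P} h' \, d\chi . \]
   Context: For a finite poset $P$, the zeta matrix $\zeta : P \times P \to \mathbb{Q}$ is given by $\zeta(x,y) = 1$ if $x \le y$ and $0$ otherwise; it is invertible, and the Euler characteristic of $P$ is $\chi(P) = \sum_{x,y \in P} \zeta^{ -1}(x,y)$ (with $\chi(\emptyset) = 0$). A filter of $P$ is a subset $Q$ that is upward closed: $x \in Q$ and $x \le y$ imply $y \in Q$. For a subset $Q \subseteq P$, $\delta_Q : P \to \mathbb{Z}$ is its indicator function. Every function $f : P \to \mathbb{Z}$ can be written as $f = \sum_i a_i \delta_{Q_i}$ with $a_i \in \mathbb{Z}$ and $Q_i$ filters of $P$; the Euler calculus (Euler integral) of $f$ is $\int_P f \, d\chi = \sum_i a_i \chi(Q_i)$, which is independent of the chosen decomposition (each $Q_i$ regarded as a poset with the induced order). -}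

module Defs where

open import Data.Nat using (ℕ; zero; suc)
open import Data.Fin using (Fin; zero; suc; _≟_)
open import Data.Bool using (Bool; true; false; if_then_else_; _∧_; not)
open import Data.List using (List; []; _∷_)
open import Data.Product using (Σ; _×_; _,_)
open import Data.Integer as ℤ using (ℤ)
open import Data.Rational as ℚ using (ℚ)
open import Relation.Binary using (Rel; Decidable; IsPartialOrder)
open import Relation.Binary.PropositionalEquality using (_≡_)
open import Relation.Nullary.Decidable using (⌊_⌋)

-- A finite poset: carrier Fin n (every finite poset is isomorphic to one),
-- with a decidable partial order.
record FinPoset : Set₁ where
  field
    size           : ℕ
    _≤_            : Rel (Fin size) _
    isPartialOrder : IsPartialOrder _≡_ _≤_
    _≤?_           : Decidable _≤_

sumFin : ∀ {n} → (Fin n → ℚ) → ℚ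
sumFin {zero}  f = ℚ.0ℚ
sumFin {suc n} f = f zero ℚ.+ sumFin (λ i → f (suc i))

module _ (P : FinPoset) where
  open FinPoset P

  Subset : Set
  Subset = Fin size → Bool

  sumOver : Subset → (Fin size → ℚ) → ℚ
  sumOver Q f = sumFin (λ z → if Q z then f z else ℚ.0ℚ)

  zeta : Fin size → Fin size → ℚ
  zeta x y = if ⌊ x ≤? y ⌋ then ℚ.1ℚ else ℚ.0ℚ

  kron : Fin size → Fin size → ℚ
  kron x y = if ⌊ x ≟ y ⌋ then ℚ.1ℚ else ℚ.0ℚ

  IsZetaInverse : Subset → (Fin size → Fin size → ℚ) → Set
  IsZetaInverse Q M =
    ∀ x y → Q x ≡ true → Q y ≡ true →
      (sumOver Q (λ z → zeta x z ℚ.* M z y) ≡ kron x y)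
      × (sumOver Q (λ z → M x z ℚ.* zeta z y) ≡ kron x y)

  -- χ(Q) = c : c is the sum of all entries of ζ_Q⁻¹.
  -- (ζ_Q is invertible, so this relation is functional; χ(∅) = 0.)
  EulerChar : Subset → ℚ → Set
  EulerChar Q c = Σ (Fin size → Fin size → ℚ) λ M →
    IsZetaInverse Q M × (c ≡ sumOver Q (λ x → sumOver Q (λ y → M x y)))

  IsFilter : Subset → Set
  IsFilter Q = ∀ x y → Q x ≡ true → x ≤ y → Q y ≡ true

  above : Fin size → Subset
  above x y = ⌊ x ≤? y ⌋ ∧ not ⌊ x ≟ y ⌋

  IsChiPoint : Fin size → Set
  IsChiPoint x = EulerChar (above x) ℚ.1ℚ

  indicator : Subset → Fin size → ℤ
  indicator Q y = if Q y then ℤ.1ℤ else ℤ.0ℤ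

  record Term : Set where
    constructor term
    field
      coeff  : ℤ
      filt   : Subset
      isFilt : IsFilter filt
      chi    : ℚ
      isChi  : EulerChar filt chi

  evalTerms : List Term → Fin size → ℤ
  evalTerms []       y = ℤ.0ℤ
  evalTerms (t ∷ ts) y = (Term.coeff t ℤ.* indicator (Term.filt t) y) ℤ.+ evalTerms ts y

  integralTerms : List Term → ℚ
  integralTerms []       = ℚ.0ℚ
  integralTerms (t ∷ ts) = (Term.coeff t ℚ./ 1) ℚ.* Term.chi t ℚ.+ integralTerms ts

  IsEulerIntegral : (Fin size → ℤ) → ℚ → Set
  IsEulerIntegral h v = Σ (List Term) λ ts →
    (∀ y → h y ≡ evalTerms ts y) × (v ≡ integralTerms ts)

-- The weighting of P is the function w with  Σ_{z ≥ x} w z = 1  for every x, i.e. w = ζ⁻¹·1;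
-- it exists by recursion downwards, w x = 1 − Σ_{z > x} w z.  On a filter Q the zeta matrix of
-- Q is the restriction of that of P, so w restricted to Q is the weighting of Q and
-- χ(Q) = Σ ζ_Q⁻¹·1 = Σ ζ_Q⁻¹ ζ_Q w = Σ_{z ∈ Q} w z.  By linearity  ∫ h dχ = Σ_z h z · w z  for
-- every h.  At a χ-point, w x = 1 − χ(P_{>x}) = 0, so the value of h at x is invisible.

module Submission where

open import Defs
open import Data.Fin using (Fin)
open import Data.Integer using (ℤ)
open import Data.Rational using (ℚ)
open import Relation.Binary.PropositionalEquality using (_≡_; _≢_)

open import Algebra.Bundles using (CommutativeRing)
import Algebra.Properties.Semiring.Sum as SemiringSum
open import Data.Bool using (Bool; true; false; if_then_else_)
open import Data.Empty using (⊥-elim)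
open import Data.Fin using (zero; suc; _≟_)
open import Data.Fin.Induction using (po-noetherian)
import Data.Integer as ℤ
import Data.Integer.Properties as ℤ
open import Data.List using ([]; _∷_)
open import Data.Nat using (zero; suc)
open import Data.Nat.Coprimality using (1-coprimeTo) renaming (sym to coprime-sym)
open import Data.Product using (_,_; proj₂)
open import Data.Rational using (mkℚ; 0ℚ; 1ℚ; _+_; _*_; -_; _-_; _/_)
open import Data.Rational.Properties
  using ( +-*-commutativeRing; +-0-group; +-assoc; +-identityˡ; +-identityʳ; +-inverseˡ
        ; *-assoc; *-identityˡ; *-identityʳ; *-zeroˡ; *-zeroʳ; *-distribʳ-+; ↥p/↧p≡p)
open import Algebra.Properties.Group +-0-group using (∙-cancelʳ)
open import Induction.WellFounded using (module All; module FixPoint)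
open import Level using (0ℓ)
open import Relation.Binary using (Rel; IsPartialOrder)
import Relation.Binary.Construct.NonStrictToStrict as ToStrict
open import Relation.Binary.PropositionalEquality
  using (refl; sym; trans; cong; cong₂; module ≡-Reasoning)
open import Relation.Nullary using (yes; no)
open import Relation.Nullary.Decidable using (⌊_⌋)

module ∑ = SemiringSum (CommutativeRing.semiring +-*-commutativeRing)

sumFin≡sum : ∀ {n} → sumFin {n} ≡ ∑.sum {n}
sumFin≡sum {zero}  = refl
sumFin≡sum {suc n} = cong (λ s f → f zero + s (λ i → f (suc i))) (sumFin≡sum {n})

sumFin-cong : ∀ {n} {f g : Fin n → ℚ} → (∀ i → f i ≡ g i) → sumFin f ≡ sumFin g
sumFin-cong {n} f≗g rewrite sumFin≡sum {n} = ∑.sum-cong-≗ f≗g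

sumFin-zero : ∀ n → sumFin {n} (λ _ → 0ℚ) ≡ 0ℚ
sumFin-zero n rewrite sumFin≡sum {n} = ∑.sum-replicate-zero n

sumFin-+ : ∀ {n} (f g : Fin n → ℚ) → sumFin (λ i → f i + g i) ≡ sumFin f + sumFin g
sumFin-+ {n} f g rewrite sumFin≡sum {n} = ∑.∑-distrib-+ f g

*-distribˡ-sumFin : ∀ {n} c (f : Fin n → ℚ) → c * sumFin f ≡ sumFin (λ i → c * f i)
*-distribˡ-sumFin {n} c f rewrite sumFin≡sum {n} = ∑.*-distribˡ-sum c f

*-distribʳ-sumFin : ∀ {n} c (f : Fin n → ℚ) → sumFin f * c ≡ sumFin (λ i → f i * c)
*-distribʳ-sumFin {n} c f rewrite sumFin≡sum {n} = ∑.*-distribʳ-sum c f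

sumFin-comm : ∀ {m n} (f : Fin m → Fin n → ℚ) →
  sumFin (λ i → sumFin (f i)) ≡ sumFin (λ j → sumFin (λ i → f i j))
sumFin-comm {m} {n} f rewrite sumFin≡sum {m} | sumFin≡sum {n} = ∑.∑-comm f

sumFin-delta : ∀ {n} (x : Fin n) (f : Fin n → ℚ) →
  sumFin (λ z → if ⌊ x ≟ z ⌋ then f z else 0ℚ) ≡ f x
sumFin-delta {suc n} zero    f = trans (cong (f zero +_) (sumFin-zero n)) (+-identityʳ (f zero))
sumFin-delta {suc n} (suc x) f =
  trans (+-identityˡ _) (trans (sumFin-cong pointwise) (sumFin-delta x (λ i → f (suc i))))
  where
  pointwise : ∀ i → (if ⌊ suc x ≟ suc i ⌋ then f (suc i) else 0ℚ) ≡
                    (if ⌊ x ≟ i ⌋ then f (suc i) else 0ℚ)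
  pointwise i with x ≟ i
  ... | yes _ = refl
  ... | no  _ = refl

if-1-* : ∀ b a → (if b then 1ℚ else 0ℚ) * a ≡ (if b then a else 0ℚ)
if-1-* true  a = *-identityˡ a
if-1-* false a = *-zeroˡ a

toℚ : ℤ → ℚ
toℚ a = a / 1

-- a / 1 is stuck for a variable a, since _/_ normalises by a gcd; its normal form mkℚ a 0 _
-- is what ℚ arithmetic computes on.
toℚ≡mkℚ : ∀ a → toℚ a ≡ mkℚ a 0 (coprime-sym (1-coprimeTo _))
toℚ≡mkℚ a = ↥p/↧p≡p (mkℚ a 0 (coprime-sym (1-coprimeTo _)))

toℚ-+ : ∀ a b → toℚ (a ℤ.+ b) ≡ toℚ a + toℚ b
toℚ-+ a b rewrite toℚ≡mkℚ a | toℚ≡mkℚ b =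
  cong (_/ 1) (cong₂ ℤ._+_ (sym (ℤ.*-identityʳ a)) (sym (ℤ.*-identityʳ b)))

∈-∉⇒≢ : ∀ {n} (Q : Fin n → Bool) {x z} → Q x ≡ true → Q z ≡ false → x ≢ z
∈-∉⇒≢ Q x∈Q z∉Q refl with trans (sym x∈Q) z∉Q
... | ()

guard : (b : Bool) → (b ≡ true → ℚ) → ℚ
guard true  k = k refl
guard false k = 0ℚ

guard-cong : ∀ b {k k′ : b ≡ true → ℚ} → (∀ e → k e ≡ k′ e) → guard b k ≡ guard b k′
guard-cong true  k≗k′ = k≗k′ refl
guard-cong false k≗k′ = refl

guard-const : ∀ b a → guard b (λ _ → a) ≡ (if b then a else 0ℚ)
guard-const true  a = refl
guard-const false a = refl

module _ (P : FinPoset) where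
  open FinPoset P
  open IsPartialOrder isPartialOrder
    using (antisym) renaming (refl to ≤-refl; trans to ≤-trans)

  _<_ : Rel (Fin size) _
  _<_ = ToStrict._<_ _≡_ _≤_

  above⇒< : ∀ {x z} → above P x z ≡ true → x < z
  above⇒< {x} {z} eq with x ≤? z | x ≟ z
  ... | yes x≤z | no x≢z = x≤z , x≢z

  <⇒above : ∀ {x z} → x < z → above P x z ≡ true
  <⇒above {x} {z} (x≤z , x≢z) with x ≤? z | x ≟ z
  ... | yes _   | no _     = refl
  ... | yes _   | yes x≡z = ⊥-elim (x≢z x≡z)
  ... | no x≰z  | _       = ⊥-elim (x≰z x≤z)

  above-isFilter : ∀ x → IsFilter P (above P x)
  above-isFilter x y z x<y y≤z with above⇒< x<y
  ... | x≤y , x≢y = <⇒above (≤-trans x≤y y≤z , λ { refl → x≢y (antisym x≤y y≤z) })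

  sumOver-cong : ∀ Q {f g : Fin size → ℚ} → (∀ z → Q z ≡ true → f z ≡ g z) →
    sumOver P Q f ≡ sumOver P Q g
  sumOver-cong Q {f} {g} f≗g = sumFin-cong pointwise
    where
    pointwise : ∀ z → (if Q z then f z else 0ℚ) ≡ (if Q z then g z else 0ℚ)
    pointwise z with Q z in eq
    ... | true  = f≗g z eq
    ... | false = refl

  sumOver-full : ∀ Q {f : Fin size → ℚ} → (∀ z → Q z ≡ false → f z ≡ 0ℚ) →
    sumOver P Q f ≡ sumFin f
  sumOver-full Q {f} f-outside = sumFin-cong pointwise
    where
    pointwise : ∀ z → (if Q z then f z else 0ℚ) ≡ f z
    pointwise z with Q z in eq
    ... | true  = refl
    ... | false = sym (f-outside z eq)

  *-distribˡ-sumOver : ∀ Q c (f : Fin size → ℚ) →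
    c * sumOver P Q f ≡ sumOver P Q (λ z → c * f z)
  *-distribˡ-sumOver Q c f =
    trans (*-distribˡ-sumFin c (λ z → if Q z then f z else 0ℚ)) (sumFin-cong pointwise)
    where
    pointwise : ∀ z → c * (if Q z then f z else 0ℚ) ≡ (if Q z then c * f z else 0ℚ)
    pointwise z with Q z
    ... | true  = refl
    ... | false = *-zeroʳ c

  *-distribʳ-sumOver : ∀ Q c (f : Fin size → ℚ) →
    sumOver P Q f * c ≡ sumOver P Q (λ z → f z * c)
  *-distribʳ-sumOver Q c f =
    trans (*-distribʳ-sumFin c (λ z → if Q z then f z else 0ℚ)) (sumFin-cong pointwise)
    where
    pointwise : ∀ z → (if Q z then f z else 0ℚ) * c ≡ (if Q z then f z * c else 0ℚ)
    pointwise z with Q z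
    ... | true  = refl
    ... | false = *-zeroˡ c

  sumOver-zero : ∀ Q → sumOver P Q (λ _ → 0ℚ) ≡ 0ℚ
  sumOver-zero Q = trans (sumOver-full Q (λ _ _ → refl)) (sumFin-zero size)

  sumOver-comm : ∀ Q R (f : Fin size → Fin size → ℚ) →
    sumOver P Q (λ x → sumOver P R (f x)) ≡ sumOver P R (λ y → sumOver P Q (λ x → f x y))
  sumOver-comm Q R f =
    trans (sumFin-cong ifQ-inside) (trans (sumFin-comm restricted) (sumFin-cong ifR-outside))
    where
    restricted : Fin size → Fin size → ℚ
    restricted x y = if Q x then (if R y then f x y else 0ℚ) else 0ℚ
    ifQ-inside : ∀ x → (if Q x then sumOver P R (f x) else 0ℚ) ≡ sumFin (restricted x)
    ifQ-inside x with Q x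
    ... | true  = refl
    ... | false = sym (sumFin-zero size)
    ifR-outside : ∀ y → sumFin (λ x → restricted x y) ≡
                        (if R y then sumOver P Q (λ x → f x y) else 0ℚ)
    ifR-outside y with R y
    ... | true  = refl
    ... | false = sumOver-zero Q

  zeta-outsideFilter : ∀ {Q x z} → IsFilter P Q → Q x ≡ true → Q z ≡ false →
    zeta P x z ≡ 0ℚ
  zeta-outsideFilter {Q} {x} {z} Q-filter x∈Q z∉Q with x ≤? z
  ... | no _    = refl
  ... | yes x≤z with trans (sym (Q-filter x z x∈Q x≤z)) z∉Q
  ...   | ()

  kron-≢ : ∀ {x z} → x ≢ z → kron P x z ≡ 0ℚ
  kron-≢ {x} {z} x≢z with x ≟ z
  ... | no _    = refl
  ... | yes x≡z = ⊥-elim (x≢z x≡z)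

  sumOver-zeta : ∀ {Q x} → IsFilter P Q → Q x ≡ true → (f : Fin size → ℚ) →
    sumOver P Q (λ z → zeta P x z * f z) ≡ sumFin (λ z → zeta P x z * f z)
  sumOver-zeta {Q} Q-filter x∈Q f = sumOver-full Q λ z z∉Q →
    trans (cong (_* f z) (zeta-outsideFilter Q-filter x∈Q z∉Q)) (*-zeroˡ (f z))

  sumOver-kron : ∀ {Q x} → Q x ≡ true → (f : Fin size → ℚ) →
    sumOver P Q (λ z → kron P x z * f z) ≡ f x
  sumOver-kron {Q} {x} x∈Q f =
    trans (sumOver-full Q kron-outside)
          (trans (sumFin-cong λ z → if-1-* ⌊ x ≟ z ⌋ (f z)) (sumFin-delta x f))
    where
    kron-outside : ∀ z → Q z ≡ false → kron P x z * f z ≡ 0ℚ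
    kron-outside z z∉Q = trans (cong (_* f z) (kron-≢ (∈-∉⇒≢ Q x∈Q z∉Q))) (*-zeroˡ (f z))

  sumFin-zeta : ∀ x (f : Fin size → ℚ) →
    sumFin (λ z → zeta P x z * f z) ≡ f x + sumOver P (above P x) f
  sumFin-zeta x f = begin
    sumFin (λ z → zeta P x z * f z)       ≡⟨ sumFin-cong split ⟩
    sumFin (λ z → at-x z + strictly-above z) ≡⟨ sumFin-+ at-x strictly-above ⟩
    sumFin at-x + sumOver P (above P x) f ≡⟨ cong (_+ sumOver P (above P x) f) (sumFin-delta x f) ⟩
    f x + sumOver P (above P x) f         ∎
    where
    open ≡-Reasoning
    at-x strictly-above : Fin size → ℚ
    at-x z           = if ⌊ x ≟ z ⌋ then f z else 0ℚ
    strictly-above z = if above P x z then f z else 0ℚ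
    split : ∀ z → zeta P x z * f z ≡ at-x z + strictly-above z
    split z with x ≤? z | x ≟ z
    ... | yes _   | yes refl = trans (*-identityˡ (f z)) (sym (+-identityʳ (f z)))
    ... | yes _   | no _     = trans (*-identityˡ (f z)) (sym (+-identityˡ (f z)))
    ... | no x≰x  | yes refl = ⊥-elim (x≰x ≤-refl)
    ... | no _    | no _     = trans (*-zeroˡ (f z)) (sym (+-identityˡ 0ℚ))

  weightingStep : ∀ x → (∀ {z} → x < z → ℚ) → ℚ
  weightingStep x w = 1ℚ - sumFin (λ z → guard (above P x z) (λ x<z → w (above⇒< x<z)))

  weightingStep-ext : ∀ x {w w′ : ∀ {z} → x < z → ℚ} →
    (∀ {z} (x<z : x < z) → w x<z ≡ w′ x<z) → weightingStep x w ≡ weightingStep x w′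
  weightingStep-ext x w≗w′ = cong (λ s → 1ℚ - s)
    (sumFin-cong λ z → guard-cong (above P x z) λ x<z → w≗w′ (above⇒< x<z))

  weighting : Fin size → ℚ
  weighting = All.wfRec (po-noetherian isPartialOrder) 0ℓ (λ _ → ℚ) weightingStep

  weighting-unfold : ∀ x → weighting x ≡ 1ℚ - sumOver P (above P x) weighting
  weighting-unfold x =
    trans (unfold-wfRec {x})
          (cong (λ s → 1ℚ - s) (sumFin-cong λ z → guard-const (above P x z) (weighting z)))
    where
    open FixPoint (po-noetherian isPartialOrder) (λ _ → ℚ) weightingStep weightingStep-ext

  weighting-above : ∀ x → weighting x + sumOver P (above P x) weighting ≡ 1ℚ
  weighting-above x = begin
    weighting x + s    ≡⟨ cong (_+ s) (weighting-unfold x) ⟩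
    (1ℚ - s) + s       ≡⟨ +-assoc 1ℚ (- s) s ⟩
    1ℚ + (- s + s)     ≡⟨ cong (1ℚ +_) (+-inverseˡ s) ⟩
    1ℚ + 0ℚ            ≡⟨ +-identityʳ 1ℚ ⟩
    1ℚ                 ∎
    where
    open ≡-Reasoning
    s = sumOver P (above P x) weighting

  weighting-isWeighting : ∀ x → sumFin (λ z → zeta P x z * weighting z) ≡ 1ℚ
  weighting-isWeighting x = trans (sumFin-zeta x weighting) (weighting-above x)

  eulerChar≡sumOver-weighting : ∀ {Q c} → IsFilter P Q → EulerChar P Q c →
    c ≡ sumOver P Q weighting
  eulerChar≡sumOver-weighting {Q} {c} Q-filter (M , M-inverse , c≡∑M) = begin
    c
      ≡⟨ c≡∑M ⟩
    ∑Q (λ x → ∑Q (λ z → M x z))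
      ≡⟨ ∑Q-cong₂ (λ x z _ z∈Q → insert-weighting (M x z) z∈Q) ⟩
    ∑Q (λ x → ∑Q (λ z → M x z * ∑Q (λ y → ζ z y * w y)))
      ≡⟨ ∑Q-cong₂ (λ x z _ _ → *-distribˡ-sumOver Q (M x z) _) ⟩
    ∑Q (λ x → ∑Q (λ z → ∑Q (λ y → M x z * (ζ z y * w y))))
      ≡⟨ ∑Q-cong (λ x _ → sumOver-comm Q Q _) ⟩
    ∑Q (λ x → ∑Q (λ y → ∑Q (λ z → M x z * (ζ z y * w y))))
      ≡⟨ ∑Q-cong₂ (λ x y _ _ → reassociate x y) ⟩
    ∑Q (λ x → ∑Q (λ y → ∑Q (λ z → M x z * ζ z y) * w y))
      ≡⟨ ∑Q-cong₂ (λ x y x∈Q y∈Q → cong (_* w y) (proj₂ (M-inverse x y x∈Q y∈Q))) ⟩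
    ∑Q (λ x → ∑Q (λ y → kron P x y * w y))
      ≡⟨ ∑Q-cong (λ x x∈Q → sumOver-kron x∈Q w) ⟩
    ∑Q w
      ∎
    where
    open ≡-Reasoning
    ∑Q = sumOver P Q
    ζ  = zeta P
    w  = weighting
    ∑Q-cong = sumOver-cong Q
    ∑Q-cong₂ : ∀ {f g : Fin size → Fin size → ℚ} →
      (∀ x y → Q x ≡ true → Q y ≡ true → f x y ≡ g x y) →
      ∑Q (λ x → ∑Q (f x)) ≡ ∑Q (λ x → ∑Q (g x))
    ∑Q-cong₂ f≗g = ∑Q-cong (λ x x∈Q → ∑Q-cong (λ y → f≗g x y x∈Q))
    insert-weighting : ∀ a {z} → Q z ≡ true → a ≡ a * ∑Q (λ y → ζ z y * w y)
    insert-weighting a {z} z∈Q = sym (begin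
      a * ∑Q (λ y → ζ z y * w y)        ≡⟨ cong (a *_) (sumOver-zeta Q-filter z∈Q w) ⟩
      a * sumFin (λ y → ζ z y * w y)    ≡⟨ cong (a *_) (weighting-isWeighting z) ⟩
      a * 1ℚ                            ≡⟨ *-identityʳ a ⟩
      a                                 ∎)
    reassociate : ∀ x y →
      ∑Q (λ z → M x z * (ζ z y * w y)) ≡ ∑Q (λ z → M x z * ζ z y) * w y
    reassociate x y = trans (∑Q-cong (λ z _ → sym (*-assoc (M x z) (ζ z y) (w y))))
                            (sym (*-distribʳ-sumOver Q (w y) (λ z → M x z * ζ z y)))

  sumOver≡sumFin-indicator : ∀ Q a (f : Fin size → ℚ) →
    sumOver P Q (λ z → toℚ a * f z) ≡ sumFin (λ z → toℚ (a ℤ.* indicator P Q z) * f z)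
  sumOver≡sumFin-indicator Q a f = sumFin-cong pointwise
    where
    pointwise : ∀ z → (if Q z then toℚ a * f z else 0ℚ) ≡ toℚ (a ℤ.* indicator P Q z) * f z
    pointwise z with Q z
    ... | true  = cong (λ b → toℚ b * f z) (sym (ℤ.*-identityʳ a))
    ... | false = trans (sym (*-zeroˡ (f z))) (cong (λ b → toℚ b * f z) (sym (ℤ.*-zeroʳ a)))

  integralTerms≡weightedSum : ∀ ts →
    integralTerms P ts ≡ sumFin (λ z → toℚ (evalTerms P ts z) * weighting z)
  integralTerms≡weightedSum [] =
    sym (trans (sumFin-cong λ z → *-zeroˡ (weighting z)) (sumFin-zero size))
  integralTerms≡weightedSum (term a Q Q-filter c c≡χQ ∷ ts) = begin
    toℚ a * c + integralTerms P ts
      ≡⟨ cong₂ _+_ (cong (toℚ a *_) (eulerChar≡sumOver-weighting Q-filter c≡χQ))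
                   (integralTerms≡weightedSum ts) ⟩
    toℚ a * sumOver P Q w + sumFin tail
      ≡⟨ cong (_+ sumFin tail) (*-distribˡ-sumOver Q (toℚ a) w) ⟩
    sumOver P Q (λ z → toℚ a * w z) + sumFin tail
      ≡⟨ cong (_+ sumFin tail) (sumOver≡sumFin-indicator Q a w) ⟩
    sumFin head + sumFin tail                ≡⟨ sym (sumFin-+ head tail) ⟩
    sumFin (λ z → head z + tail z)           ≡⟨ sumFin-cong (λ z → sym (distrib z)) ⟩
    sumFin (λ z → toℚ (aδ z ℤ.+ evalTerms P ts z) * w z)
      ∎
    where
    open ≡-Reasoning
    w = weighting
    aδ : Fin size → ℤ
    aδ z = a ℤ.* indicator P Q z
    head tail : Fin size → ℚ
    head z = toℚ (aδ z) * w z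
    tail z = toℚ (evalTerms P ts z) * w z
    distrib : ∀ z → toℚ (aδ z ℤ.+ evalTerms P ts z) * w z ≡ head z + tail z
    distrib z = trans (cong (_* w z) (toℚ-+ (aδ z) (evalTerms P ts z)))
                      (*-distribʳ-+ (w z) (toℚ (aδ z)) (toℚ (evalTerms P ts z)))

  eulerIntegral≡weightedSum : ∀ {h v} → IsEulerIntegral P h v →
    v ≡ sumFin (λ z → toℚ (h z) * weighting z)
  eulerIntegral≡weightedSum (ts , h≗ts , v≡∫ts) =
    trans v≡∫ts (trans (integralTerms≡weightedSum ts)
                       (sumFin-cong λ z → cong (λ a → toℚ a * weighting z) (sym (h≗ts z))))

  chiPoint⇒weighting≡0 : ∀ {x} → IsChiPoint P x → weighting x ≡ 0ℚ
  chiPoint⇒weighting≡0 {x} χ↑x≡1 = ∙-cancelʳ 1ℚ (weighting x) 0ℚ (begin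
    weighting x + 1ℚ
      ≡⟨ cong (weighting x +_) (eulerChar≡sumOver-weighting (above-isFilter x) χ↑x≡1) ⟩
    weighting x + sumOver P (above P x) weighting ≡⟨ weighting-above x ⟩
    1ℚ                                            ≡⟨ sym (+-identityˡ 1ℚ) ⟩
    0ℚ + 1ℚ                                       ∎)
    where open ≡-Reasoning

proposition4p1 : (P : FinPoset) (x : Fin (FinPoset.size P)) →
    IsChiPoint P x →
    (h h' : Fin (FinPoset.size P) → ℤ) →
    (∀ y → y ≢ x → h y ≡ h' y) →
    (v v' : ℚ) → IsEulerIntegral P h v → IsEulerIntegral P h' v' →
    v ≡ v'
proposition4p1 P x x-chiPoint h h' h≡h'-off-x v v' ∫h≡v ∫h'≡v' = begin
  v                                ≡⟨ eulerIntegral≡weightedSum P ∫h≡v ⟩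
  sumFin (λ z → toℚ (h z) * w z)   ≡⟨ sumFin-cong agree ⟩
  sumFin (λ z → toℚ (h' z) * w z)  ≡⟨ sym (eulerIntegral≡weightedSum P ∫h'≡v') ⟩
  v'                               ∎
  where
  open ≡-Reasoning
  w = weighting P
  agree : ∀ z → toℚ (h z) * w z ≡ toℚ (h' z) * w z
  agree z with z ≟ x
  ... | no z≢x   = cong (λ a → toℚ a * w z) (h≡h'-off-x z z≢x)
  ... | yes refl rewrite chiPoint⇒weighting≡0 P x-chiPoint =
    trans (*-zeroʳ (toℚ (h x))) (sym (*-zeroʳ (toℚ (h' x))))
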